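{- Let $n\ge 2$ and let $u,v$ be two distinct vertices of the $n$-dimensional hierarchical cubic network $HCN_{n}$. Then $|N_{HCN_{n}}(u)\cap N_{HCN_{n}}(v)|=2$ if $u$ and $v$ belong to the same $n$-cube $xQ_n$ and $N_{HCN_{n}}(u)\cap N_{HCN_{n}}(v)\neq\emptyset$; $|N_{HCN_{n}}(u)\cap N_{HCN_{n}}(v)|=1$ if $u$ and $v$ belong to different $n$-cubes and $N_{HCN_{n}}(u)\cap N_{HCN_{n}}(v)\neq\emptyset$; and $|N_{HCN_{n}}(u)\cap N_{HCN_{n}}(v)|=0$ otherwise.
   Context: For $n\ge 1$ let $V_n=\{0,1\}^n$; for $x\in V_n$, $\overline{x}$ denotes its bitwise complement. $HCN_n$ has vertex set $V_n\times V_n$. For each $x\in V_n$, the vertices $\{(x,y):y\in V_n\}$ induce a copy $xQ_n$ of the $n$-dimensional hypercube ($(x,y)\sim(x,y')$ iff $y,y'$ differ in exactly one bit); these $2^n$ subgraphs are the $n$-cubes of $HCN_n$. In addition, each vertex $(x,y)$ is joined to $(y,x)$ if $x\neq y$, and to $(\overline{x},\overline{y})$ if $x=y$. These are all the edges. $N_{HCN_n}(u)$ denotes the set of neighbours of $u$. -}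

module Defs where

open import Data.Bool using (Bool; true; false; not)
import Data.Bool as B
open import Data.Nat using (ℕ; zero; suc; _+_)
import Data.Nat as N
open import Data.Vec using (Vec; []; _∷_; map)
open import Data.Vec.Properties using (≡-dec)
open import Data.List using (List; []; _∷_; _++_; filter; length; concatMap)
import Data.List as L
open import Data.Product using (_×_; _,_; proj₁; proj₂; ∃)
open import Data.Sum using (_⊎_)
open import Relation.Nullary using (Dec; ¬_; yes; no; _×-dec_; _⊎-dec_; ¬?)
open import Relation.Binary.PropositionalEquality using (_≡_; _≢_)

V : ℕ → Set
V n = Vec Bool n

comp : ∀ {n} → V n → V n
comp = map not

ham : ∀ {n} → V n → V n → ℕ
ham [] [] = 0
ham (a ∷ x) (b ∷ y) with a B.≟ b
... | yes _ = ham x y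
... | no _  = suc (ham x y)

Vertex : ℕ → Set
Vertex n = V n × V n

_≟V_ : ∀ {n} → (x y : V n) → Dec (x ≡ y)
_≟V_ = ≡-dec B._≟_

Adj : ∀ {n} → Vertex n → Vertex n → Set
Adj (x , y) (x' , y') =
  (x ≡ x' × ham y y' ≡ 1)
  ⊎ (x ≢ y × (x' ≡ y × y' ≡ x))
  ⊎ (x ≡ y × (x' ≡ comp x × y' ≡ comp y))

adj? : ∀ {n} (u v : Vertex n) → Dec (Adj u v)
adj? (x , y) (x' , y') =
  ((x ≟V x') ×-dec (ham y y' N.≟ 1))
  ⊎-dec (¬? (x ≟V y) ×-dec ((x' ≟V y) ×-dec (y' ≟V x)))
  ⊎-dec ((x ≟V y) ×-dec ((x' ≟V comp x) ×-dec (y' ≟V comp y)))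

allV : (n : ℕ) → List (V n)
allV zero = [] ∷ []
allV (suc n) = L.map (false ∷_) (allV n) ++ L.map (true ∷_) (allV n)

allVertex : (n : ℕ) → List (Vertex n)
allVertex n = concatMap (λ x → L.map (x ,_) (allV n)) (allV n)

CommonNbr : ∀ {n} → Vertex n → Vertex n → Vertex n → Set
CommonNbr u v w = Adj u w × Adj v w

commonNbrCount : ∀ {n} → Vertex n → Vertex n → ℕ
commonNbrCount {n} u v = length (filter (λ w → adj? u w ×-dec adj? v w) (allVertex n))

SameCube : ∀ {n} → Vertex n → Vertex n → Set
SameCube u v = proj₁ u ≡ proj₁ v

-- Every vertex (x , y) has exactly one neighbour outside its cube xQ_n, its external
-- neighbour (y , x) or (x̄ , ȳ), and the external-neighbour relation is functional and
-- injective. Hence two distinct vertices of one cube share only cube neighbours, and two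
-- vertices of Q_n with a common neighbour have exactly two of them. Vertices u, v in
-- different cubes share no cube neighbour and no external neighbour, so a common neighbour
-- is the external neighbour of one of them, lying in the cube of the other. Both kinds
-- cannot occur together: the external neighbour of v would then be u itself or the
-- antipode of u in its cube, at distance 0 or n ≥ 2 from u.
module Submission where

open import Defs
open import Data.Bool using (Bool; true; false; _≟_)
open import Data.Bool.Properties using (not-involutive; not-¬; ¬-not)
open import Data.Empty using (⊥; ⊥-elim)
open import Data.List using (List; []; _∷_; length; filter; concatMap; cartesianProduct)
import Data.List as List
open import Data.List.Properties using (filter-accept; filter-reject; filter-none; filter-≐)
import Data.List.Relation.Unary.All as All
open import Data.List.Relation.Unary.Any using (here; there)
open import Data.List.Relation.Unary.AllPairs using ([]; _∷_)
open import Data.List.Relation.Unary.Unique.Propositional using (Unique)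
import Data.List.Relation.Unary.Unique.Propositional.Properties as Unique
open import Data.List.Relation.Binary.Disjoint.Propositional using (Disjoint)
open import Data.List.Membership.Propositional using (_∈_)
open import Data.List.Membership.Propositional.Properties
  using (∈-map⁺; ∈-map⁻; ∈-++⁺ˡ; ∈-++⁺ʳ; ∈-cartesianProduct⁺)
open import Data.Nat using (ℕ; zero; suc; _+_; _≥_; s≤s; z≤n)
open import Data.Nat.Properties using (suc-injective; +-suc)
open import Data.Product using (_×_; _,_; proj₁; proj₂; ∃; ∃₂)
import Data.Product.Properties as Product
open import Data.Sum using (_⊎_; inj₁; inj₂)
import Data.Sum as Sum
open import Data.Vec using ([]; _∷_)
open import Data.Vec.Properties using (∷-injectiveˡ; ∷-injectiveʳ)
open import Function using (_∘_; id; case_of_)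
open import Level using (0ℓ)
open import Relation.Binary.Definitions using (DecidableEquality)
open import Relation.Binary.PropositionalEquality
open import Relation.Nullary using (¬_; yes; no; contradiction)
open import Relation.Unary using (Pred; Decidable; Empty; _≐_; _⊆_; _∪_)
open import Relation.Unary.Properties using (_∪?_)

ExactlyOne : {A : Set} → Pred A 0ℓ → Set
ExactlyOne P = ∃ λ a → P ≐ (_≡ a)

ExactlyTwo : {A : Set} → Pred A 0ℓ → Set
ExactlyTwo P = ∃₂ λ a b → a ≢ b × P ≐ (_≡ a) ∪ (_≡ b)

module _ {A : Set} {P : Pred A 0ℓ} (P? : Decidable P) where

  length-filter-empty : Empty P → ∀ xs → length (filter P? xs) ≡ 0
  length-filter-empty ∅ xs = cong length (filter-none P? (All.universal ∅ xs))

  length-filter-singleton : ∀ {a xs} → Unique xs → a ∈ xs → P ≐ (_≡ a) →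
    length (filter P? xs) ≡ 1
  length-filter-singleton {xs = x ∷ xs} (x∉xs ∷ _) (here refl) (P⊆ , P⊇) =
    begin
      length (filter P? (x ∷ xs))  ≡⟨ cong length (filter-accept P? (P⊇ refl)) ⟩
      suc (length (filter P? xs))  ≡⟨ cong (suc ∘ length) (filter-none P? (All.map P-fails x∉xs)) ⟩
      1                            ∎
    where
    open ≡-Reasoning
    P-fails : ∀ {y} → x ≢ y → ¬ P y
    P-fails x≢y = x≢y ∘ sym ∘ P⊆
  length-filter-singleton {xs = x ∷ xs} (x∉xs ∷ xs-unique) (there a∈xs) P≐@(P⊆ , _) =
    trans (cong length (filter-reject P? (All.lookup x∉xs a∈xs ∘ P⊆)))
          (length-filter-singleton xs-unique a∈xs P≐)

module _ {A : Set} {P Q : Pred A 0ℓ} (P? : Decidable P) (Q? : Decidable Q) where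

  length-filter-∪ : (∀ {x} → P x → Q x → ⊥) → ∀ xs →
    length (filter (P? ∪? Q?) xs) ≡ length (filter P? xs) + length (filter Q? xs)
  length-filter-∪ disjoint [] = refl
  length-filter-∪ disjoint (x ∷ xs) with P? x | Q? x
  ... | yes p | yes q = ⊥-elim (disjoint p q)
  ... | yes _ | no _  = cong suc (length-filter-∪ disjoint xs)
  ... | no _  | yes _ = trans (cong suc (length-filter-∪ disjoint xs)) (sym (+-suc _ _))
  ... | no _  | no _  = length-filter-∪ disjoint xs

module Enumeration {A : Set} {xs : List A}
                   (xs-unique : Unique xs) (xs-complete : ∀ a → a ∈ xs) where

  length-filter-ExactlyOne : {P : Pred A 0ℓ} (P? : Decidable P) → ExactlyOne P →
    length (filter P? xs) ≡ 1
  length-filter-ExactlyOne P? (a , P≐) = length-filter-singleton P? xs-unique (xs-complete a) P≐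

  length-filter-ExactlyTwo : DecidableEquality A → {P : Pred A 0ℓ} (P? : Decidable P) →
    ExactlyTwo P → length (filter P? xs) ≡ 2
  length-filter-ExactlyTwo _≟A_ P? (a , b , a≢b , P≐) =
    begin
      length (filter P? xs)
        ≡⟨ cong length (filter-≐ P? (≟a ∪? ≟b) P≐ xs) ⟩
      length (filter (≟a ∪? ≟b) xs)
        ≡⟨ length-filter-∪ ≟a ≟b (λ x≡a x≡b → a≢b (trans (sym x≡a) x≡b)) xs ⟩
      length (filter ≟a xs) + length (filter ≟b xs)
        ≡⟨ cong₂ _+_ (length-filter-ExactlyOne ≟a (a , id , id))
                     (length-filter-ExactlyOne ≟b (b , id , id)) ⟩
      2
        ∎
    where
    open ≡-Reasoning
    ≟a : Decidable (_≡ a)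
    ≟a = _≟A a
    ≟b : Decidable (_≡ b)
    ≟b = _≟A b

allV-unique : ∀ n → Unique (allV n)
allV-unique zero    = All.[] ∷ []
allV-unique (suc n) =
  Unique.++⁺ (Unique.map⁺ ∷-injectiveʳ (allV-unique n))
             (Unique.map⁺ ∷-injectiveʳ (allV-unique n))
             heads-differ
  where
  heads-differ : Disjoint (List.map (false ∷_) (allV n)) (List.map (true ∷_) (allV n))
  heads-differ (p , q) with ∈-map⁻ (false ∷_) p | ∈-map⁻ (true ∷_) q
  ... | _ , _ , refl | _ , _ , ()

∈-allV : ∀ {n} (x : V n) → x ∈ allV n
∈-allV []          = here refl
∈-allV (false ∷ x) = ∈-++⁺ˡ (∈-map⁺ (false ∷_) (∈-allV x))
∈-allV (true ∷ x)  = ∈-++⁺ʳ _ (∈-map⁺ (true ∷_) (∈-allV x))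

concatMap-pairs≡cartesianProduct : {A B : Set} (xs : List A) (ys : List B) →
  concatMap (λ x → List.map (x ,_) ys) xs ≡ cartesianProduct xs ys
concatMap-pairs≡cartesianProduct []       ys = refl
concatMap-pairs≡cartesianProduct (x ∷ xs) ys =
  cong (List.map (x ,_) ys List.++_) (concatMap-pairs≡cartesianProduct xs ys)

allVertex-unique : ∀ n → Unique (allVertex n)
allVertex-unique n =
  subst Unique (sym (concatMap-pairs≡cartesianProduct (allV n) (allV n)))
        (Unique.cartesianProduct⁺ (allV-unique n) (allV-unique n))

∈-allVertex : ∀ {n} (u : Vertex n) → u ∈ allVertex n
∈-allVertex {n} (x , y) =
  subst (_ ∈_) (sym (concatMap-pairs≡cartesianProduct (allV n) (allV n)))
        (∈-cartesianProduct⁺ (∈-allV x) (∈-allV y))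

_≟Vertex_ : ∀ {n} → DecidableEquality (Vertex n)
_≟Vertex_ = Product.≡-dec _≟V_ _≟V_

≢-common⇒≡ : {a b c : Bool} → a ≢ c → b ≢ c → a ≡ b
≢-common⇒≡ a≢c b≢c = trans (¬-not a≢c) (sym (¬-not b≢c))

comp-involutive : ∀ {n} (x : V n) → comp (comp x) ≡ x
comp-involutive []      = refl
comp-involutive (a ∷ x) = cong₂ _∷_ (not-involutive a) (comp-involutive x)

comp-injective : ∀ {n} {x y : V n} → comp x ≡ comp y → x ≡ y
comp-injective {x = x} {y} eq =
  trans (sym (comp-involutive x)) (trans (cong comp eq) (comp-involutive y))

comp-≢ : ∀ {n} (x : V (suc n)) → comp x ≢ x
comp-≢ (a ∷ x) eq = not-¬ refl (sym (∷-injectiveˡ eq))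

ham-∷-≡ : ∀ {n} a (x y : V n) → ham (a ∷ x) (a ∷ y) ≡ ham x y
ham-∷-≡ a x y with a ≟ a
... | yes _   = refl
... | no a≢a  = contradiction refl a≢a

ham-∷-≢ : ∀ {n} {a b} (x y : V n) → a ≢ b → ham (a ∷ x) (b ∷ y) ≡ suc (ham x y)
ham-∷-≢ {a = a} {b} x y a≢b with a ≟ b
... | yes a≡b = contradiction a≡b a≢b
... | no _    = refl

ham-self : ∀ {n} (x : V n) → ham x x ≡ 0
ham-self []      = refl
ham-self (a ∷ x) = trans (ham-∷-≡ a x x) (ham-self x)

ham-sym : ∀ {n} (x y : V n) → ham x y ≡ ham y x
ham-sym []      []      = refl
ham-sym (a ∷ x) (b ∷ y) with a ≟ b | b ≟ a
... | yes _   | yes _   = ham-sym x y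
... | no _    | no _    = cong suc (ham-sym x y)
... | yes a≡b | no b≢a  = contradiction (sym a≡b) b≢a
... | no a≢b  | yes b≡a = contradiction (sym b≡a) a≢b

ham-comp : ∀ {n} (x : V n) → ham x (comp x) ≡ n
ham-comp []      = refl
ham-comp (a ∷ x) = trans (ham-∷-≢ x (comp x) (not-¬ {a} refl)) (cong suc (ham-comp x))

ham≡0⇒≡ : ∀ {n} {x y : V n} → ham x y ≡ 0 → x ≡ y
ham≡0⇒≡ {x = []}    {[]}    _ = refl
ham≡0⇒≡ {x = a ∷ x} {b ∷ y} h with a ≟ b
ham≡0⇒≡ {x = a ∷ x} {b ∷ y} h  | yes refl = cong (a ∷_) (ham≡0⇒≡ h)
ham≡0⇒≡ {x = a ∷ x} {b ∷ y} () | no _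

ham≡1-∷ : ∀ {n} a c {x z : V n} → ham (a ∷ x) (c ∷ z) ≡ 1 →
  (a ≡ c × ham x z ≡ 1) ⊎ (a ≢ c × x ≡ z)
ham≡1-∷ a c h with a ≟ c
... | yes a≡c = inj₁ (a≡c , h)
... | no a≢c  = inj₂ (a≢c , ham≡0⇒≡ (suc-injective h))

CubeCommonNbr : ∀ {n} → V n → V n → Pred (V n) 0ℓ
CubeCommonNbr y y' z = ham y z ≡ 1 × ham y' z ≡ 1

cube-common-∷ : ∀ {n} a {y y' : V n} → y ≢ y' → ExactlyTwo (CubeCommonNbr y y') →
  ExactlyTwo (CubeCommonNbr (a ∷ y) (a ∷ y'))
cube-common-∷ a {y} {y'} y≢y' (z₁ , z₂ , z₁≢z₂ , sub , sup) =
  a ∷ z₁ , a ∷ z₂ , z₁≢z₂ ∘ ∷-injectiveʳ , sub′ , sup′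
  where
  sub′ : CubeCommonNbr (a ∷ y) (a ∷ y') ⊆ (_≡ a ∷ z₁) ∪ (_≡ a ∷ z₂)
  sub′ {c ∷ w} (h , h') with ham≡1-∷ a c h | ham≡1-∷ a c h'
  ... | inj₁ (refl , d) | inj₁ (_ , d')     = Sum.map (cong (a ∷_)) (cong (a ∷_)) (sub (d , d'))
  ... | inj₁ (a≡c , _)  | inj₂ (a≢c , _)    = contradiction a≡c a≢c
  ... | inj₂ (a≢c , _)  | inj₁ (a≡c , _)    = contradiction a≡c a≢c
  ... | inj₂ (_ , y≡w)  | inj₂ (_ , y'≡w)   = contradiction (trans y≡w (sym y'≡w)) y≢y'

  prepend : ∀ {z} → CubeCommonNbr y y' z → CubeCommonNbr (a ∷ y) (a ∷ y') (a ∷ z)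
  prepend {z} (d , d') = trans (ham-∷-≡ a y z) d , trans (ham-∷-≡ a y' z) d'

  sup′ : (_≡ a ∷ z₁) ∪ (_≡ a ∷ z₂) ⊆ CubeCommonNbr (a ∷ y) (a ∷ y')
  sup′ (inj₁ refl) = prepend (sup (inj₁ refl))
  sup′ (inj₂ refl) = prepend (sup (inj₂ refl))

cube-common-split : ∀ {n} {a b} {y y' : V n} → a ≢ b → ham y y' ≡ 1 →
  ExactlyTwo (CubeCommonNbr (a ∷ y) (b ∷ y'))
cube-common-split {a = a} {b} {y} {y'} a≢b d =
  a ∷ y' , b ∷ y , a≢b ∘ ∷-injectiveˡ , sub , sup
  where
  sub : CubeCommonNbr (a ∷ y) (b ∷ y') ⊆ (_≡ a ∷ y') ∪ (_≡ b ∷ y)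
  sub {c ∷ w} (h , h') with ham≡1-∷ a c h | ham≡1-∷ b c h'
  ... | inj₁ (refl , _) | inj₂ (_ , y'≡w)   = inj₁ (cong (a ∷_) (sym y'≡w))
  ... | inj₂ (_ , y≡w)  | inj₁ (refl , _)   = inj₂ (cong (b ∷_) (sym y≡w))
  ... | inj₁ (refl , _) | inj₁ (b≡a , _)    = contradiction (sym b≡a) a≢b
  ... | inj₂ (a≢c , _)  | inj₂ (b≢c , _)    = contradiction (≢-common⇒≡ a≢c b≢c) a≢b

  sup : (_≡ a ∷ y') ∪ (_≡ b ∷ y) ⊆ CubeCommonNbr (a ∷ y) (b ∷ y')
  sup (inj₁ refl) = trans (ham-∷-≡ a y y') d
                  , trans (ham-∷-≢ y' y' (a≢b ∘ sym)) (cong suc (ham-self y'))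
  sup (inj₂ refl) = trans (ham-∷-≢ y y a≢b) (cong suc (ham-self y))
                  , trans (ham-∷-≡ b y' y) (trans (ham-sym y' y) d)

cube-common-neighbours : ∀ {n} {y y' z : V n} → y ≢ y' → CubeCommonNbr y y' z →
  ExactlyTwo (CubeCommonNbr y y')
cube-common-neighbours {y = []} {[]} y≢y' _ = contradiction refl y≢y'
cube-common-neighbours {y = a ∷ y} {b ∷ y'} {c ∷ z} y≢y' (h , h')
  with ham≡1-∷ a c h | ham≡1-∷ b c h'
... | inj₁ (refl , d) | inj₁ (refl , d')  =
  cube-common-∷ a tails≢ (cube-common-neighbours tails≢ (d , d'))
  where
  tails≢ : y ≢ y'
  tails≢ = y≢y' ∘ cong (a ∷_)
... | inj₁ (refl , d) | inj₂ (b≢a , refl) = cube-common-split (b≢a ∘ sym) d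
... | inj₂ (a≢b , refl) | inj₁ (refl , d') = cube-common-split a≢b (trans (ham-sym y y') d')
... | inj₂ (a≢c , refl) | inj₂ (b≢c , refl) =
  contradiction (cong (_∷ y) (≢-common⇒≡ a≢c b≢c)) y≢y'

-- Adj u w is definitionally CubeEdge u w ⊎ External u w.
CubeEdge : ∀ {n} → Vertex n → Vertex n → Set
CubeEdge (x , y) (x' , y') = x ≡ x' × ham y y' ≡ 1

External : ∀ {n} → Vertex n → Vertex n → Set
External (x , y) (x' , y') =
  (x ≢ y × (x' ≡ y × y' ≡ x)) ⊎ (x ≡ y × (x' ≡ comp x × y' ≡ comp y))

External-functional : ∀ {n} {u w w' : Vertex n} → External u w → External u w' → w ≡ w'
External-functional (inj₁ (_ , refl , refl)) (inj₁ (_ , refl , refl)) = refl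
External-functional (inj₂ (_ , refl , refl)) (inj₂ (_ , refl , refl)) = refl
External-functional (inj₁ (x≢y , _)) (inj₂ (x≡y , _)) = contradiction x≡y x≢y
External-functional (inj₂ (x≡y , _)) (inj₁ (x≢y , _)) = contradiction x≡y x≢y

External-injective : ∀ {n} {u u' w : Vertex n} → External u w → External u' w → u ≡ u'
External-injective (inj₁ (_ , refl , refl)) (inj₁ (_ , refl , refl)) = refl
External-injective (inj₂ (refl , refl , _)) (inj₂ (refl , x≡ , _)) =
  cong (λ t → t , t) (comp-injective x≡)
External-injective (inj₁ (x≢y , refl , refl)) (inj₂ (refl , y≡ , x≡)) =
  contradiction (trans x≡ (sym y≡)) x≢y
External-injective (inj₂ (refl , y≡ , x≡)) (inj₁ (x≢y , refl , refl)) =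
  contradiction (trans x≡ (sym y≡)) x≢y

External-leaves-cube : ∀ {n} {x y a b : V (suc n)} → External (x , y) (a , b) → a ≢ x
External-leaves-cube (inj₁ (x≢y , refl , _)) = x≢y ∘ sym
External-leaves-cube (inj₂ (_ , refl , _))   = comp-≢ _

External-mutual : ∀ {n} {x y x' y' b b' : V n} →
  External (x' , y') (x , b) → External (x , y) (x' , b') → b ≡ y ⊎ b ≡ comp y
External-mutual (inj₁ (_ , refl , refl)) (inj₁ (_ , refl , _)) = inj₁ refl
External-mutual (inj₁ (_ , refl , refl)) (inj₂ (refl , refl , _)) = inj₂ refl
External-mutual (inj₂ (refl , _ , refl)) (inj₁ (_ , refl , _)) = inj₂ refl
External-mutual (inj₂ (refl , refl , refl)) (inj₂ (refl , _ , _)) = inj₁ refl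

bridges-exclusive : ∀ {n} {u v w w' : Vertex (2 + n)} →
  CubeEdge u w → External v w → External u w' → CubeEdge v w' → ⊥
bridges-exclusive {u = _ , y} (refl , h) f f' (refl , _)
  with External-mutual f f'
... | inj₁ refl = case trans (sym (ham-self y)) h of λ ()
... | inj₂ refl = case trans (sym (ham-comp y)) h of λ ()

common-neighbour-bridge : ∀ {n} {u v w : Vertex n} → proj₁ u ≢ proj₁ v → CommonNbr u v w →
  (CubeEdge u w × External v w) ⊎ (External u w × CubeEdge v w)
common-neighbour-bridge x≢x' (inj₁ (x≡a , _) , inj₁ (x'≡a , _)) =
  contradiction (trans x≡a (sym x'≡a)) x≢x'
common-neighbour-bridge _ (inj₁ e , inj₂ f)  = inj₁ (e , f)
common-neighbour-bridge _ (inj₂ f , inj₁ e)  = inj₂ (f , e)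
common-neighbour-bridge x≢x' (inj₂ f , inj₂ f') =
  contradiction (cong proj₁ (External-injective f f')) x≢x'

differentCube-ExactlyOne : ∀ {n} {u v : Vertex (2 + n)} → proj₁ u ≢ proj₁ v →
  ∃ (CommonNbr u v) → ExactlyOne (CommonNbr u v)
differentCube-ExactlyOne {u = u} {v} x≢x' (w₀ , c₀) = w₀ , only-w₀ , λ { refl → c₀ }
  where
  only-w₀ : CommonNbr u v ⊆ (_≡ w₀)
  only-w₀ c with common-neighbour-bridge x≢x' c | common-neighbour-bridge x≢x' c₀
  ... | inj₁ (_ , f) | inj₁ (_ , f₀) = External-functional f f₀
  ... | inj₂ (f , _) | inj₂ (f₀ , _) = External-functional f f₀
  ... | inj₁ (e , f) | inj₂ (f₀ , e₀) = ⊥-elim (bridges-exclusive e f f₀ e₀)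
  ... | inj₂ (f , e) | inj₁ (e₀ , f₀) = ⊥-elim (bridges-exclusive e₀ f₀ f e)

sameCube-common⇒cube : ∀ {n} {x y y' a b : V (suc n)} → y ≢ y' →
  CommonNbr (x , y) (x , y') (a , b) → a ≡ x × CubeCommonNbr y y' b
sameCube-common⇒cube _ (inj₁ (refl , h) , inj₁ (_ , h')) = refl , h , h'
sameCube-common⇒cube _ (inj₁ (refl , _) , inj₂ f) = contradiction refl (External-leaves-cube f)
sameCube-common⇒cube _ (inj₂ f , inj₁ (refl , _)) = contradiction refl (External-leaves-cube f)
sameCube-common⇒cube y≢y' (inj₂ f , inj₂ f') =
  contradiction (cong proj₂ (External-injective f f')) y≢y'

sameCube-ExactlyTwo : ∀ {n} {x y y' : V (suc n)} → y ≢ y' →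
  ∃ (CommonNbr (x , y) (x , y')) → ExactlyTwo (CommonNbr (x , y) (x , y'))
sameCube-ExactlyTwo {x = x} {y} {y'} y≢y' (_ , c₀)
  with cube-common-neighbours y≢y' (proj₂ (sameCube-common⇒cube y≢y' c₀))
... | z₁ , z₂ , z₁≢z₂ , sub , sup =
  (x , z₁) , (x , z₂) , z₁≢z₂ ∘ cong proj₂ , sub′ , sup′
  where
  sub′ : CommonNbr (x , y) (x , y') ⊆ (_≡ (x , z₁)) ∪ (_≡ (x , z₂))
  sub′ c with sameCube-common⇒cube y≢y' c
  ... | refl , d = Sum.map (cong (x ,_)) (cong (x ,_)) (sub d)

  in-cube : ∀ {z} → CubeCommonNbr y y' z → CommonNbr (x , y) (x , y') (x , z)
  in-cube (d , d') = inj₁ (refl , d) , inj₁ (refl , d')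

  sup′ : (_≡ (x , z₁)) ∪ (_≡ (x , z₂)) ⊆ CommonNbr (x , y) (x , y')
  sup′ (inj₁ refl) = in-cube (sup (inj₁ refl))
  sup′ (inj₂ refl) = in-cube (sup (inj₂ refl))

lemma8 : (n : ℕ) → n ≥ 2 → (u v : Vertex n) → u ≢ v →
    ((SameCube u v → ∃ (CommonNbr u v) → commonNbrCount u v ≡ 2)
    × (¬ SameCube u v → ∃ (CommonNbr u v) → commonNbrCount u v ≡ 1)
    × (¬ ∃ (CommonNbr u v) → commonNbrCount u v ≡ 0))
lemma8 (suc (suc m)) (s≤s (s≤s z≤n)) (x , _) _ u≢v =
    (λ { refl → length-filter-ExactlyTwo _≟Vertex_ _
                  ∘ sameCube-ExactlyTwo (u≢v ∘ cong (x ,_)) })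
  , (λ x≢x' → length-filter-ExactlyOne _ ∘ differentCube-ExactlyOne x≢x')
  , (λ ∄ → length-filter-empty _ (λ w c → ∄ (w , c)) (allVertex _))
  where open Enumeration (allVertex-unique (suc (suc m))) ∈-allVertex
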